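{- Let $m \geq 3$ and $n \ge 6$. Then $\gamma_{r2}(C_{m} \Box C_n) \le \left\lceil \frac{m}{3}\right\rceil (n + \beta)$, where $\beta = 0$ if $n \equiv 0 \pmod 6$, $\beta = 1$ if $n \equiv 1,2,3,5 \pmod 6$, and $\beta=2$ if $n \equiv 4 \pmod 6$.
   Context: A 2-rainbow dominating function (2RDF) of a graph $G$ assigns to each vertex a subset of $\{1,2\}$ so that every vertex $v$ with $f(v)=\emptyset$ satisfies $\bigcup_{u\in N(v)} f(u)=\{1,2\}$; its weight is $\sum_v |f(v)|$ and $\gamma_{r2}(G)$ is the minimum weight of a 2RDF of $G$. $C_m \Box C_n$ is the Cartesian product of the cycles $C_m$ and $C_n$. -}

module Defs where

open import Data.Nat using (ℕ; zero; suc; _+_; _*_; _≤_; _%_; NonZero)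
open import Data.Nat.DivMod using (_/_)
open import Data.Fin using (Fin; toℕ)
open import Data.Product using (_×_; _,_; ∃-syntax; Σ)
open import Data.Sum using (_⊎_)
open import Data.List using (List; map; allFin; concatMap)
open import Data.Nat.ListAction using (sum)
open import Data.Nat.Properties using (<-≤-trans)
open import Data.Nat using (_<_; s≤s; z≤n; >-nonZero)
open import Relation.Binary.PropositionalEquality using (_≡_)

-- Subsets of {1,2}
data Label : Set where
  ∅ one two both : Label

∣_∣ˡ : Label → ℕ
∣ ∅ ∣ˡ    = 0
∣ one ∣ˡ  = 1
∣ two ∣ˡ  = 1
∣ both ∣ˡ = 2

data Has1 : Label → Set where
  h1-one  : Has1 one
  h1-both : Has1 both

data Has2 : Label → Set where
  h2-two  : Has2 two
  h2-both : Has2 both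

CycleAdj : (n : ℕ) .{{_ : NonZero n}} → Fin n → Fin n → Set
CycleAdj n i j = (toℕ j ≡ suc (toℕ i) % n) ⊎ (toℕ i ≡ suc (toℕ j) % n)

Vertex : ℕ → ℕ → Set
Vertex m n = Fin m × Fin n

Adj : (m n : ℕ) .{{_ : NonZero m}} .{{_ : NonZero n}} → Vertex m n → Vertex m n → Set
Adj m n (a , b) (c , d) = ((a ≡ c) × CycleAdj n b d) ⊎ ((b ≡ d) × CycleAdj m a c)

Is2RDF : (m n : ℕ) .{{_ : NonZero m}} .{{_ : NonZero n}} → (Vertex m n → Label) → Set
Is2RDF m n f = ∀ v → f v ≡ ∅ →
  (∃[ u ] (Adj m n v u × Has1 (f u))) × (∃[ w ] (Adj m n v w × Has2 (f w)))

weight : (m n : ℕ) → (Vertex m n → Label) → ℕ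
weight m n f = sum (concatMap (λ a → map (λ b → ∣ f (a , b) ∣ˡ) (allFin n)) (allFin m))

γr2≤ : (m n : ℕ) .{{_ : NonZero m}} .{{_ : NonZero n}} → ℕ → Set
γr2≤ m n k = Σ (Vertex m n → Label) (λ f → Is2RDF m n f × weight m n f ≤ k)

β : ℕ → ℕ
β n with n % 6
... | 0 = 0
... | 4 = 2
... | _ = 1

⌈_/3⌉ : ℕ → ℕ
⌈ m /3⌉ = (m + 2) / 3

nz : {k n : ℕ} → 1 ≤ k → k ≤ n → NonZero n
nz p q = >-nonZero (<-≤-trans p q)

module Submission where

-- The labelling is a product: vertex (a, b) gets the label of (type of row a, type of column b).
-- The rows are cut into ⌈m/3⌉ blocks: copies of a periodic block g₀ g₁ g₂, then one block of
-- the m mod 3 remaining rows; the columns are copies of a 6-column period followed by a seam of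
-- n mod 6 columns. On the period every block has weight at most one per column, and on a seam of
-- s columns at most s + β(s), so each block weighs at most n + β(n).
-- Whether a vertex is rainbow dominated depends only on the cyclic windows (previous, own, next)
-- of its row and column types, and every cyclic window of a word P^(k+1) S is a cyclic window of
-- P or of P S. So domination reduces to finitely many pairs of windows, checked by evaluation.

open import Defs
open import Data.Nat using (ℕ; zero; suc; _+_; _*_; _%_; _/_; _≤_; _<_; s≤s; z≤n; s<s; NonZero; _<?_; _≤?_)
open import Data.Nat.Properties
open import Data.Nat.DivMod
  using (result; _divMod_; _mod_; m<n⇒m%n≡m; n%n≡0; [m+n]%n≡m%n; [m+kn]%n≡m%n; %-distribˡ-+; m%n%n≡m%n;
         +-distrib-/-∣ˡ; m*n/n≡m)
open import Data.Nat.Divisibility using (n∣m*n)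
open import Data.Nat.ListAction using (sum)
open import Data.Nat.ListAction.Properties using (sum-++)
open import Data.Nat.Tactic.RingSolver using (solve-∀)
open import Data.Fin as Fin using (Fin; toℕ; fromℕ; inject₁)
open import Data.Fin.Patterns using (0F; 1F; 2F; 3F; 4F; 5F)
open import Data.Fin.Properties using (toℕ-fromℕ; toℕ-inject₁; toℕ-fromℕ<; toℕ<n) renaming (all? to allFin?)
open import Data.List using (List; []; _∷_; _++_; map; concat; replicate; take; length; lookup; tabulate; allFin)
open import Data.List.Properties
  using (++-assoc; ++-identityʳ; concat-++; map-++; map-∘; map-cong; map-tabulate; tabulate-lookup;
         length-++; length-replicate; length-tabulate)
open import Data.List.Membership.Propositional using (_∈_)
open import Data.List.Membership.Propositional.Properties using (∈-++⁺ˡ; ∈-++⁺ʳ; ∈-++⁻)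
open import Data.List.Relation.Binary.Subset.Propositional using (_⊆_)
open import Data.List.Relation.Unary.All as All using (All; []; _∷_)
open import Data.List.Relation.Unary.All.Properties using (++⁺; replicate⁺)
open import Data.List.Relation.Unary.Any as Any using (Any; here; there; any?)
open import Data.List.Relation.Unary.Any.Properties using (map⁻)
open import Data.Vec as Vec using (Vec; []; _∷_)
open import Data.Product using (_×_; _,_; ∃-syntax; ∃₂)
open import Data.Sum using (inj₁; inj₂; [_,_]′)
open import Data.Empty using (⊥-elim)
open import Function using (_∘_)
open import Relation.Nullary using (Dec; yes; no)
open import Relation.Nullary.Decidable using (from-yes; _×-dec_; _→-dec_)
open import Relation.Unary using (Decidable)
open import Relation.Binary.PropositionalEquality

suc-% : ∀ n m .{{_ : NonZero m}} → suc (n % m) % m ≡ suc n % m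
suc-% n m = begin
  (1 + n % m) % m         ≡⟨ %-distribˡ-+ 1 (n % m) m ⟩
  (1 % m + n % m % m) % m ≡⟨ cong (λ k → (1 % m + k) % m) (m%n%n≡m%n n m) ⟩
  (1 % m + n % m) % m     ≡⟨ %-distribˡ-+ 1 n m ⟨
  (1 + n) % m             ∎
  where open ≡-Reasoning

m≥d⇒m≡[1+k]*d+r : ∀ {m} d .{{_ : NonZero d}} → d ≤ m → ∃₂ λ k (r : Fin d) → m ≡ suc k * d + toℕ r
m≥d⇒m≡[1+k]*d+r {m} d d≤m with m divMod d
... | result zero    r m≡r+0  = ⊥-elim (<⇒≱ (subst (_< d) (sym (trans m≡r+0 (+-identityʳ _))) (toℕ<n r)) d≤m)
... | result (suc k) r m≡r+kd = k , r , trans m≡r+kd (+-comm (toℕ r) (suc k * d))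

⌈k*3+r/3⌉ : ∀ k r → ⌈ k * 3 + r /3⌉ ≡ k + ⌈ r /3⌉
⌈k*3+r/3⌉ k r = begin
  (k * 3 + r + 2) / 3     ≡⟨ cong (_/ 3) (+-assoc (k * 3) r 2) ⟩
  (k * 3 + (r + 2)) / 3   ≡⟨ +-distrib-/-∣ˡ (r + 2) (n∣m*n k) ⟩
  k * 3 / 3 + (r + 2) / 3 ≡⟨ cong (_+ (r + 2) / 3) (m*n/n≡m k 3) ⟩
  k + ⌈ r /3⌉             ∎
  where open ≡-Reasoning

β-cong : ∀ {m n} → m % 6 ≡ n % 6 → β m ≡ β n
β-cong m%6≡n%6 rewrite m%6≡n%6 = refl

sum-concat : (xss : List (List ℕ)) → sum (concat xss) ≡ sum (map sum xss)
sum-concat []         = refl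
sum-concat (xs ∷ xss) = trans (sum-++ xs (concat xss)) (cong (sum xs +_) (sum-concat xss))

module _ {A : Set} where

  sum-map-++ : (f : A → ℕ) (xs ys : List A) → sum (map f (xs ++ ys)) ≡ sum (map f xs) + sum (map f ys)
  sum-map-++ f xs ys = trans (cong sum (map-++ f xs ys)) (sum-++ (map f xs) (map f ys))

  sum-map-concat : (f : A → ℕ) (xss : List (List A)) → sum (map f (concat xss)) ≡ sum (map (sum ∘ map f) xss)
  sum-map-concat f []         = refl
  sum-map-concat f (xs ∷ xss) =
    trans (sum-map-++ f xs (concat xss)) (cong (sum (map f xs) +_) (sum-map-concat f xss))

  sum-map-concat-replicate : (f : A → ℕ) (n : ℕ) (xs : List A) →
    sum (map f (concat (replicate n xs))) ≡ n * sum (map f xs)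
  sum-map-concat-replicate f zero    xs = refl
  sum-map-concat-replicate f (suc n) xs =
    trans (sum-map-++ f xs _) (cong (sum (map f xs) +_) (sum-map-concat-replicate f n xs))

  sum-map-affine : (n : ℕ) (f g : A → ℕ) (xs : List A) →
    sum (map (λ x → n * f x + g x) xs) ≡ n * sum (map f xs) + sum (map g xs)
  sum-map-affine n f g []       = cong (_+ 0) (sym (*-zeroʳ n))
  sum-map-affine n f g (x ∷ xs) =
    trans (cong (n * f x + g x +_) (sum-map-affine n f g xs)) (regroup n (f x) (g x) _ _)
    where
    regroup : ∀ n a b c d → n * a + b + (n * c + d) ≡ n * (a + c) + (b + d)
    regroup = solve-∀

  sum-map-≤ : {f : A → ℕ} {c : ℕ} {xs : List A} → All (λ x → f x ≤ c) xs → sum (map f xs) ≤ length xs * c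
  sum-map-≤ []             = z≤n
  sum-map-≤ (fx≤c ∷ fxs≤c) = +-mono-≤ fx≤c (sum-map-≤ fxs≤c)

  length-concat-replicate : (n : ℕ) (xs : List A) → length (concat (replicate n xs)) ≡ n * length xs
  length-concat-replicate zero    xs = refl
  length-concat-replicate (suc n) xs =
    trans (length-++ xs) (cong (length xs +_) (length-concat-replicate n xs))

  map-lookup-allFin : {B : Set} (g : A → B) (xs : List A) →
    map (λ a → g (lookup xs a)) (allFin (length xs)) ≡ map g xs
  map-lookup-allFin g xs = begin
    map (λ a → g (lookup xs a)) (tabulate (λ a → a)) ≡⟨ map-tabulate (λ a → a) (λ a → g (lookup xs a)) ⟩
    tabulate (λ a → g (lookup xs a))                ≡⟨ map-tabulate (lookup xs) g ⟨
    map g (tabulate (lookup xs))                    ≡⟨ cong (map g) (tabulate-lookup xs) ⟩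
    map g xs                                        ∎
    where open ≡-Reasoning

-- Windows of cyclic words

module _ {A : Set} where

  windows : List A → List (A × A × A)
  windows (x ∷ y ∷ z ∷ xs) = (x , y , z) ∷ windows (y ∷ z ∷ xs)
  windows _                = []

  cyclicWindows : List A → List (A × A × A)
  cyclicWindows xs = windows (xs ++ take 2 xs)

  windows-++ : (xs ys : List A) → windows (xs ++ ys) ≡ windows (xs ++ take 2 ys) ++ windows ys
  windows-++ (x ∷ y ∷ z ∷ xs) ys          = cong ((x , y , z) ∷_) (windows-++ (y ∷ z ∷ xs) ys)
  windows-++ []               []          = refl
  windows-++ []               (_ ∷ [])    = refl
  windows-++ []               (_ ∷ _ ∷ _) = refl
  windows-++ (_ ∷ [])         []          = refl
  windows-++ (_ ∷ [])         (_ ∷ [])    = refl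
  windows-++ (_ ∷ [])         (_ ∷ _ ∷ _) = refl
  windows-++ (_ ∷ _ ∷ [])     []          = refl
  windows-++ (_ ∷ _ ∷ [])     (_ ∷ [])    = refl
  windows-++ (_ ∷ _ ∷ [])     (_ ∷ _ ∷ _) = refl

  cyclicWindows-++ : (x y : A) (xs ys : List A) →
    cyclicWindows (x ∷ y ∷ xs ++ x ∷ y ∷ ys) ≡ cyclicWindows (x ∷ y ∷ xs) ++ cyclicWindows (x ∷ y ∷ ys)
  cyclicWindows-++ x y xs ys = begin
    windows (x ∷ y ∷ (xs ++ x ∷ y ∷ ys) ++ x ∷ y ∷ [])
      ≡⟨ cong (λ zs → windows (x ∷ y ∷ zs)) (++-assoc xs (x ∷ y ∷ ys) (x ∷ y ∷ [])) ⟩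
    windows (x ∷ y ∷ xs ++ x ∷ y ∷ ys ++ x ∷ y ∷ [])
      ≡⟨ windows-++ (x ∷ y ∷ xs) (x ∷ y ∷ ys ++ x ∷ y ∷ []) ⟩
    cyclicWindows (x ∷ y ∷ xs) ++ cyclicWindows (x ∷ y ∷ ys) ∎
    where open ≡-Reasoning

  cyclicWindows-periodic : (x y : A) (xs ys : List A) (n : ℕ) →
    cyclicWindows (concat (replicate (suc n) (x ∷ y ∷ xs)) ++ ys) ⊆
    cyclicWindows (x ∷ y ∷ xs) ++ cyclicWindows (x ∷ y ∷ xs ++ ys)
  cyclicWindows-periodic x y xs ys zero {w} =
    ∈-++⁺ʳ (cyclicWindows (x ∷ y ∷ xs))
      ∘ subst (λ p → w ∈ cyclicWindows (p ++ ys)) (++-identityʳ (x ∷ y ∷ xs))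
  cyclicWindows-periodic x y xs ys (suc n) =
    [ ∈-++⁺ˡ , cyclicWindows-periodic x y xs ys n ]′
      ∘ ∈-++⁻ (cyclicWindows (x ∷ y ∷ xs))
      ∘ subst (_ ∈_) unfold
    where
    unfold : cyclicWindows (concat (replicate (2 + n) (x ∷ y ∷ xs)) ++ ys) ≡
             cyclicWindows (x ∷ y ∷ xs) ++ cyclicWindows (concat (replicate (suc n) (x ∷ y ∷ xs)) ++ ys)
    unfold = trans (cong cyclicWindows (++-assoc (x ∷ y ∷ xs) _ ys)) (cyclicWindows-++ x y xs _)

  at : A → List A → ℕ → A
  at d []       _       = d
  at d (x ∷ xs) zero    = x
  at d (x ∷ xs) (suc i) = at d xs i

  lookup≡at : (d : A) (xs : List A) (a : Fin (length xs)) → lookup xs a ≡ at d xs (toℕ a)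
  lookup≡at d (x ∷ xs) Fin.zero    = refl
  lookup≡at d (x ∷ xs) (Fin.suc a) = lookup≡at d xs a

  at-++ˡ : (d : A) (xs ys : List A) {i : ℕ} → i < length xs → at d (xs ++ ys) i ≡ at d xs i
  at-++ˡ d (x ∷ xs) ys {zero}  _         = refl
  at-++ˡ d (x ∷ xs) ys {suc i} (s≤s i<n) = at-++ˡ d xs ys i<n

  at-++ʳ : (d : A) (xs ys : List A) (i : ℕ) → at d (xs ++ ys) (length xs + i) ≡ at d ys i
  at-++ʳ d []       ys i = refl
  at-++ʳ d (x ∷ xs) ys i = at-++ʳ d xs ys i

  windows-at : (d : A) (ys : List A) (i : ℕ) → 2 + i < length ys →
    (at d ys i , at d ys (1 + i) , at d ys (2 + i)) ∈ windows ys
  windows-at d (x ∷ y ∷ z ∷ ys) zero    _         = here refl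
  windows-at d (x ∷ y ∷ z ∷ ys) (suc i) (s≤s i<n) = there (windows-at d (y ∷ z ∷ ys) i i<n)
  windows-at d (_ ∷ _ ∷ [])     _       (s≤s (s≤s ()))
  windows-at d (_ ∷ [])         _       (s≤s ())
  windows-at d []               _       ()

  private module CyclicWord (x y : A) (zs : List A) where

    xs : List A
    xs = x ∷ y ∷ zs

    m : ℕ
    m = length xs

    unrolled : List A
    unrolled = xs ++ take 2 xs

    length-unrolled : length unrolled ≡ 2 + m
    length-unrolled = trans (length-++ xs) (+-comm m 2)

    at-unrolled : ∀ i → i < 2 + m → at x unrolled i ≡ at x xs (i % m)
    at-unrolled i i<2+m with i <? m
    ... | yes i<m = trans (at-++ˡ x xs _ i<m) (cong (at x xs) (sym (m<n⇒m%n≡m i<m)))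
    ... | no i≮m with m≤n⇒∃[o]m+o≡n (≮⇒≥ i≮m)
    ...   | o , refl = begin
      at x unrolled (m + o) ≡⟨ at-++ʳ x xs (take 2 xs) o ⟩
      at x (x ∷ y ∷ []) o   ≡⟨ at-take-2 o o<2 ⟩
      at x xs o             ≡⟨ cong (at x xs) [m+o]%m≡o ⟨
      at x xs ((m + o) % m) ∎
      where
      open ≡-Reasoning
      o<2 : o < 2
      o<2 = +-cancelˡ-< m o 2 (subst (m + o <_) (+-comm 2 m) i<2+m)
      [m+o]%m≡o : (m + o) % m ≡ o
      [m+o]%m≡o = trans (cong (_% m) (+-comm m o))
                        (trans ([m+n]%n≡m%n o m) (m<n⇒m%n≡m (≤-trans o<2 (s≤s (s≤s z≤n)))))
      at-take-2 : ∀ o → o < 2 → at x (x ∷ y ∷ []) o ≡ at x xs o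
      at-take-2 0 _ = refl
      at-take-2 1 _ = refl
      at-take-2 (suc (suc _)) (s≤s (s≤s ()))

    prev : Fin m → Fin m
    prev Fin.zero    = fromℕ (suc (length zs))
    prev (Fin.suc a) = inject₁ a

    next : Fin m → Fin m
    next a = suc (toℕ a) mod m

    prev-adjacent : (a : Fin m) → toℕ a ≡ suc (toℕ (prev a)) % m
    prev-adjacent Fin.zero    =
      sym (trans (cong (λ k → suc k % m) (toℕ-fromℕ (suc (length zs)))) (n%n≡0 m))
    prev-adjacent (Fin.suc a) =
      sym (trans (cong (λ k → suc k % m) (toℕ-inject₁ a)) (m<n⇒m%n≡m (s≤s (toℕ<n a))))

    next-adjacent : (a : Fin m) → toℕ (next a) ≡ suc (toℕ a) % m
    next-adjacent a = toℕ-fromℕ< _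

    window-around : (a : Fin m) → (lookup xs (prev a) , lookup xs a , lookup xs (next a)) ∈ cyclicWindows xs
    window-around a =
      subst (_∈ cyclicWindows xs) (cong₂ _,_ at-j (cong₂ _,_ at-1+j at-2+j))
        (windows-at x unrolled j (subst (2 + j <_) (sym length-unrolled) (+-monoʳ-< 2 j<m)))
      where
      open ≡-Reasoning
      j : ℕ
      j = toℕ (prev a)
      j<m : j < m
      j<m = toℕ<n (prev a)
      at-j : at x unrolled j ≡ lookup xs (prev a)
      at-j = trans (at-++ˡ x xs _ j<m) (sym (lookup≡at x xs (prev a)))
      at-1+j : at x unrolled (1 + j) ≡ lookup xs a
      at-1+j = begin
        at x unrolled (1 + j) ≡⟨ at-unrolled (1 + j) (m<n⇒m<1+n (s<s j<m)) ⟩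
        at x xs (suc j % m)   ≡⟨ cong (at x xs) (prev-adjacent a) ⟨
        at x xs (toℕ a)       ≡⟨ lookup≡at x xs a ⟨
        lookup xs a           ∎
      at-2+j : at x unrolled (2 + j) ≡ lookup xs (next a)
      at-2+j = begin
        at x unrolled (2 + j)         ≡⟨ at-unrolled (2 + j) (+-monoʳ-< 2 j<m) ⟩
        at x xs ((2 + j) % m)         ≡⟨ cong (at x xs) (suc-% (suc j) m) ⟨
        at x xs (suc (suc j % m) % m) ≡⟨ cong (λ k → at x xs (suc k % m)) (prev-adjacent a) ⟨
        at x xs (suc (toℕ a) % m)     ≡⟨ cong (at x xs) (next-adjacent a) ⟨
        at x xs (toℕ (next a))        ≡⟨ lookup≡at x xs (next a) ⟨
        lookup xs (next a)            ∎

  cyclic-neighbours : (xs : List A) .{{_ : NonZero (length xs)}} → 2 ≤ length xs → (a : Fin (length xs)) →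
    ∃₂ λ a⁻ a⁺ → CycleAdj (length xs) a a⁻ × CycleAdj (length xs) a a⁺ ×
                 (lookup xs a⁻ , lookup xs a , lookup xs a⁺) ∈ cyclicWindows xs
  cyclic-neighbours (x ∷ y ∷ zs) _ a =
    prev a , next a , inj₂ (prev-adjacent a) , inj₁ (next-adjacent a) , window-around a
    where open CyclicWord x y zs
  cyclic-neighbours (_ ∷ []) (s≤s ())

-- Rainbow domination of product labellings

Dominated : Label → List Label → Set
Dominated l ls = l ≡ ∅ → Any Has1 ls × Any Has2 ls

has1? : Decidable Has1
has1? ∅    = no λ ()
has1? one  = yes h1-one
has1? two  = no λ ()
has1? both = yes h1-both

has2? : Decidable Has2
has2? ∅    = no λ ()
has2? one  = no λ ()
has2? two  = yes h2-two
has2? both = yes h2-both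

≡∅? : (l : Label) → Dec (l ≡ ∅)
≡∅? ∅    = yes refl
≡∅? one  = no λ ()
≡∅? two  = no λ ()
≡∅? both = no λ ()

dominated? : (l : Label) (ls : List Label) → Dec (Dominated l ls)
dominated? l ls = ≡∅? l →-dec (any? has1? ls ×-dec any? has2? ls)

∃-adjacent : {V : Set} {Adjacent : V → V → Set} {P : Label → Set} (f : V → Label) {v : V} {vs : List V} →
  All (Adjacent v) vs → Any P (map f vs) → ∃[ u ] (Adjacent v u × P (f u))
∃-adjacent f adjacent p = Any.lookup (map⁻ p) , All.lookupAny adjacent (map⁻ p)

module Labelling {R C : Set} (label : R → C → Label) where

  labelling : (rs : List R) (cs : List C) → Vertex (length rs) (length cs) → Label
  labelling rs cs (a , b) = label (lookup rs a) (lookup cs b)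

  WindowDominated : R × R × R → C × C × C → Set
  WindowDominated (r⁻ , r , r⁺) (c⁻ , c , c⁺) =
    Dominated (label r c) (label r⁻ c ∷ label r⁺ c ∷ label r c⁻ ∷ label r c⁺ ∷ [])

  windowDominated? : ∀ u v → Dec (WindowDominated u v)
  windowDominated? (r⁻ , r , r⁺) (c⁻ , c , c⁺) = dominated? _ _

  labelling-is2RDF : (rs : List R) (cs : List C) .{{_ : NonZero (length rs)}} .{{_ : NonZero (length cs)}} →
    2 ≤ length rs → 2 ≤ length cs →
    (∀ {u v} → u ∈ cyclicWindows rs → v ∈ cyclicWindows cs → WindowDominated u v) →
    Is2RDF (length rs) (length cs) (labelling rs cs)
  labelling-is2RDF rs cs 2≤rs 2≤cs dominated (a , b) empty
    with cyclic-neighbours rs 2≤rs a | cyclic-neighbours cs 2≤cs b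
  ... | a⁻ , a⁺ , a~a⁻ , a~a⁺ , u∈ | b⁻ , b⁺ , b~b⁻ , b~b⁺ , v∈
    with dominated u∈ v∈ empty
  ... | has1 , has2 =
    ∃-adjacent {Adjacent = Adj _ _} (labelling rs cs) adjacent has1 ,
    ∃-adjacent {Adjacent = Adj _ _} (labelling rs cs) adjacent has2
    where
    adjacent : All (Adj (length rs) (length cs) (a , b)) ((a⁻ , b) ∷ (a⁺ , b) ∷ (a , b⁻) ∷ (a , b⁺) ∷ [])
    adjacent = inj₂ (refl , a~a⁻) ∷ inj₂ (refl , a~a⁺) ∷ inj₁ (refl , b~b⁻) ∷ inj₁ (refl , b~b⁺) ∷ []

  rowWeight : R → List C → ℕ
  rowWeight r cs = sum (map (λ c → ∣ label r c ∣ˡ) cs)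

  blockWeight : List R → List C → ℕ
  blockWeight rs cs = sum (map (λ r → rowWeight r cs) rs)

  weight-labelling : (rs : List R) (cs : List C) →
    weight (length rs) (length cs) (labelling rs cs) ≡ blockWeight rs cs
  weight-labelling rs cs = begin
    sum (concat (map row (allFin (length rs))))
      ≡⟨ sum-concat (map row (allFin _)) ⟩
    sum (map sum (map row (allFin (length rs))))
      ≡⟨ cong sum (map-∘ {g = sum} {f = row} (allFin _)) ⟨
    sum (map (sum ∘ row) (allFin (length rs)))
      ≡⟨ cong sum (map-cong row-sum (allFin _)) ⟩
    sum (map (λ a → rowWeight (lookup rs a) cs) (allFin (length rs)))
      ≡⟨ cong sum (map-lookup-allFin (λ r → rowWeight r cs) rs) ⟩
    blockWeight rs cs ∎
    where
    open ≡-Reasoning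
    row : Fin (length rs) → List ℕ
    row a = map (λ b → ∣ label (lookup rs a) (lookup cs b) ∣ˡ) (allFin (length cs))
    row-sum : ∀ a → sum (row a) ≡ rowWeight (lookup rs a) cs
    row-sum a = cong sum (map-lookup-allFin (λ c → ∣ label (lookup rs a) c ∣ˡ) cs)

-- g₀ g₁ g₂ are the periodic rows; x₀, resp. y₀ y₁, are the remaining rows when m ≡ 1, resp. 2 (mod 3).
-- Column seam s j is the j-th of the s = n mod 6 columns following the copies of the period.
data Row : Set where
  g₀ g₁ g₂ x₀ y₀ y₁ : Row

data Column : Set where
  period : Fin 6 → Column
  seam   : (s : Fin 6) → Fin (toℕ s) → Column

periodLabels : Row → Vec Label 6
periodLabels g₀ = one ∷ ∅   ∷ ∅   ∷ two  ∷ ∅   ∷ ∅   ∷ []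
periodLabels g₁ = ∅   ∷ ∅   ∷ one ∷ ∅    ∷ ∅   ∷ two ∷ []
periodLabels g₂ = ∅   ∷ two ∷ ∅   ∷ ∅    ∷ one ∷ ∅   ∷ []
periodLabels x₀ = one ∷ two ∷ ∅   ∷ both ∷ one ∷ one ∷ []
periodLabels y₀ = one ∷ ∅   ∷ ∅   ∷ two  ∷ ∅   ∷ ∅   ∷ []
periodLabels y₁ = ∅   ∷ two ∷ one ∷ ∅    ∷ one ∷ two ∷ []

seamLabels : (s : Fin 6) → Row → Vec Label (toℕ s)
seamLabels 0F _  = []
seamLabels 1F g₀ = one ∷ []
seamLabels 1F g₁ = two ∷ []
seamLabels 1F g₂ = ∅   ∷ []
seamLabels 1F x₀ = one ∷ []
seamLabels 1F y₀ = one ∷ []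
seamLabels 1F y₁ = ∅   ∷ []
seamLabels 2F g₀ = one ∷ ∅   ∷ []
seamLabels 2F g₁ = ∅   ∷ two ∷ []
seamLabels 2F g₂ = ∅   ∷ two ∷ []
seamLabels 2F x₀ = one ∷ ∅   ∷ []
seamLabels 2F y₀ = one ∷ ∅   ∷ []
seamLabels 2F y₁ = ∅   ∷ one ∷ []
seamLabels 3F g₀ = one ∷ ∅   ∷ ∅    ∷ []
seamLabels 3F g₁ = ∅   ∷ ∅   ∷ both ∷ []
seamLabels 3F g₂ = ∅   ∷ two ∷ ∅    ∷ []
seamLabels 3F x₀ = one ∷ two ∷ ∅    ∷ []
seamLabels 3F y₀ = one ∷ ∅   ∷ ∅    ∷ []
seamLabels 3F y₁ = ∅   ∷ two ∷ two  ∷ []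
seamLabels 4F g₀ = one ∷ ∅   ∷ ∅   ∷ two  ∷ []
seamLabels 4F g₁ = ∅   ∷ ∅   ∷ one ∷ two  ∷ []
seamLabels 4F g₂ = ∅   ∷ two ∷ ∅   ∷ one  ∷ []
seamLabels 4F x₀ = one ∷ two ∷ ∅   ∷ one  ∷ []
seamLabels 4F y₀ = one ∷ ∅   ∷ ∅   ∷ both ∷ []
seamLabels 4F y₁ = ∅   ∷ two ∷ ∅   ∷ one  ∷ []
seamLabels 5F g₀ = one ∷ ∅   ∷ ∅   ∷ two  ∷ ∅   ∷ []
seamLabels 5F g₁ = ∅   ∷ ∅   ∷ one ∷ ∅    ∷ two ∷ []
seamLabels 5F g₂ = ∅   ∷ two ∷ ∅   ∷ ∅    ∷ one ∷ []
seamLabels 5F x₀ = one ∷ two ∷ ∅   ∷ both ∷ ∅   ∷ []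
seamLabels 5F y₀ = one ∷ ∅   ∷ ∅   ∷ both ∷ ∅   ∷ []
seamLabels 5F y₁ = ∅   ∷ two ∷ ∅   ∷ one  ∷ one ∷ []

label : Row → Column → Label
label r (period i) = Vec.lookup (periodLabels r) i
label r (seam s j) = Vec.lookup (seamLabels s r) j

open Labelling label

periodRows : List Row
periodRows = g₀ ∷ g₁ ∷ g₂ ∷ []

remainderBlocks : Fin 3 → List (List Row)
remainderBlocks 0F = []
remainderBlocks 1F = (x₀ ∷ []) ∷ []
remainderBlocks 2F = (y₀ ∷ y₁ ∷ []) ∷ []

rowBlocks : ℕ → Fin 3 → List (List Row)
rowBlocks k t = replicate (suc k) periodRows ++ remainderBlocks t

rows : ℕ → Fin 3 → List Row
rows k t = concat (rowBlocks k t)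

periodColumns : List Column
periodColumns = tabulate period

seamColumns : Fin 6 → List Column
seamColumns s = tabulate (seam s)

columns : ℕ → Fin 6 → List Column
columns q s = concat (replicate (suc q) periodColumns) ++ seamColumns s

rows-periodic : ∀ k t → rows k t ≡ concat (replicate (suc k) periodRows) ++ concat (remainderBlocks t)
rows-periodic k t = sym (concat-++ (replicate (suc k) periodRows) (remainderBlocks t))

rowWindows : Fin 3 → List (Row × Row × Row)
rowWindows t = cyclicWindows periodRows ++ cyclicWindows (periodRows ++ concat (remainderBlocks t))

columnWindows : Fin 6 → List (Column × Column × Column)
columnWindows s = cyclicWindows periodColumns ++ cyclicWindows (periodColumns ++ seamColumns s)

rows-windows : ∀ k t → cyclicWindows (rows k t) ⊆ rowWindows t
rows-windows k t {u} = cyclicWindows-periodic g₀ g₁ (g₂ ∷ []) (concat (remainderBlocks t)) k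
                     ∘ subst (λ rs → u ∈ cyclicWindows rs) (rows-periodic k t)

columns-windows : ∀ q s → cyclicWindows (columns q s) ⊆ columnWindows s
columns-windows q s =
  cyclicWindows-periodic (period 0F) (period 1F) (tabulate (λ i → period (Fin.suc (Fin.suc i)))) (seamColumns s) q

windows-dominated : ∀ t s → All (λ u → All (WindowDominated u) (columnWindows s)) (rowWindows t)
windows-dominated = from-yes (allFin? λ t → allFin? λ s →
  All.all? (λ u → All.all? (windowDominated? u) (columnWindows s)) (rowWindows t))

rows-columns-is2RDF : ∀ k t q s → Is2RDF (length (rows k t)) (length (columns q s)) (labelling (rows k t) (columns q s))
rows-columns-is2RDF k t q s = labelling-is2RDF (rows k t) (columns q s) (s≤s (s≤s z≤n)) (s≤s (s≤s z≤n))
  λ u∈ v∈ → All.lookup (All.lookup (windows-dominated t s) (rows-windows k t u∈)) (columns-windows q s v∈)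

length-rows : ∀ k t → length (rows k t) ≡ suc k * 3 + toℕ t
length-rows k t = begin
  length (rows k t)
    ≡⟨ cong length (rows-periodic k t) ⟩
  length (concat (replicate (suc k) periodRows) ++ concat (remainderBlocks t))
    ≡⟨ length-++ (concat (replicate (suc k) periodRows)) ⟩
  length (concat (replicate (suc k) periodRows)) + length (concat (remainderBlocks t))
    ≡⟨ cong₂ _+_ (length-concat-replicate (suc k) periodRows) (remainder t) ⟩
  suc k * 3 + toℕ t ∎
  where
  open ≡-Reasoning
  remainder : ∀ t → length (concat (remainderBlocks t)) ≡ toℕ t
  remainder 0F = refl
  remainder 1F = refl
  remainder 2F = refl

⌈rows/3⌉ : ∀ k t → ⌈ length (rows k t) /3⌉ ≡ length (rowBlocks k t)
⌈rows/3⌉ k t = begin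
  ⌈ length (rows k t) /3⌉
    ≡⟨ cong ⌈_/3⌉ (length-rows k t) ⟩
  ⌈ suc k * 3 + toℕ t /3⌉
    ≡⟨ ⌈k*3+r/3⌉ (suc k) (toℕ t) ⟩
  suc k + ⌈ toℕ t /3⌉
    ≡⟨ cong₂ _+_ (length-replicate (suc k)) (remainder t) ⟨
  length (replicate (suc k) periodRows) + length (remainderBlocks t)
    ≡⟨ length-++ (replicate (suc k) periodRows) ⟨
  length (rowBlocks k t) ∎
  where
  open ≡-Reasoning
  remainder : ∀ t → length (remainderBlocks t) ≡ ⌈ toℕ t /3⌉
  remainder 0F = refl
  remainder 1F = refl
  remainder 2F = refl

length-columns : ∀ q s → length (columns q s) ≡ suc q * 6 + toℕ s
length-columns q s = begin
  length (columns q s)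
    ≡⟨ length-++ (concat (replicate (suc q) periodColumns)) ⟩
  length (concat (replicate (suc q) periodColumns)) + length (seamColumns s)
    ≡⟨ cong₂ _+_ (length-concat-replicate (suc q) periodColumns) (length-tabulate (seam s)) ⟩
  suc q * 6 + toℕ s ∎
  where open ≡-Reasoning

β-columns : ∀ q s → β (length (columns q s)) ≡ β (toℕ s)
β-columns q s = β-cong {length (columns q s)} {toℕ s} (begin
  length (columns q s) % 6 ≡⟨ cong (_% 6) (trans (length-columns q s) (+-comm (suc q * 6) (toℕ s))) ⟩
  (toℕ s + suc q * 6) % 6  ≡⟨ [m+kn]%n≡m%n (toℕ s) (suc q) 6 ⟩
  toℕ s % 6                ∎)
  where open ≡-Reasoning

BlockBounded : List Row → Set
BlockBounded B = blockWeight B periodColumns ≤ 6 × (∀ s → blockWeight B (seamColumns s) ≤ toℕ s + β (toℕ s))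

blockBounded? : ∀ B → Dec (BlockBounded B)
blockBounded? B = (_ ≤? 6) ×-dec allFin? (λ s → _ ≤? toℕ s + β (toℕ s))

rowBlocks-bounded : ∀ k t → All BlockBounded (rowBlocks k t)
rowBlocks-bounded k t = ++⁺ (replicate⁺ (suc k) (from-yes (blockBounded? periodRows)))
                            (from-yes (allFin? λ t → All.all? blockBounded? (remainderBlocks t)) t)

blockWeight-columns : ∀ B q s →
  blockWeight B (columns q s) ≡ suc q * blockWeight B periodColumns + blockWeight B (seamColumns s)
blockWeight-columns B q s = begin
  sum (map (λ r → rowWeight r (columns q s)) B)
    ≡⟨ cong sum (map-cong rowWeight-columns B) ⟩
  sum (map (λ r → suc q * rowWeight r periodColumns + rowWeight r (seamColumns s)) B)
    ≡⟨ sum-map-affine (suc q) _ _ B ⟩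
  suc q * blockWeight B periodColumns + blockWeight B (seamColumns s) ∎
  where
  open ≡-Reasoning
  rowWeight-columns : ∀ r → rowWeight r (columns q s) ≡ suc q * rowWeight r periodColumns + rowWeight r (seamColumns s)
  rowWeight-columns r =
    trans (sum-map-++ ∣label∣ (concat (replicate (suc q) periodColumns)) (seamColumns s))
          (cong (_+ rowWeight r (seamColumns s)) (sum-map-concat-replicate ∣label∣ (suc q) periodColumns))
    where
    ∣label∣ : Column → ℕ
    ∣label∣ c = ∣ label r c ∣ˡ

blockWeight-columns-≤ : ∀ q s {B} → BlockBounded B →
  blockWeight B (columns q s) ≤ length (columns q s) + β (length (columns q s))
blockWeight-columns-≤ q s {B} (period≤ , seam≤) = begin
  blockWeight B (columns q s)
    ≡⟨ blockWeight-columns B q s ⟩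
  suc q * blockWeight B periodColumns + blockWeight B (seamColumns s)
    ≤⟨ +-mono-≤ (*-monoʳ-≤ (suc q) period≤) (seam≤ s) ⟩
  suc q * 6 + (toℕ s + β (toℕ s))
    ≡⟨ +-assoc (suc q * 6) (toℕ s) _ ⟨
  suc q * 6 + toℕ s + β (toℕ s)
    ≡⟨ cong₂ _+_ (length-columns q s) (β-columns q s) ⟨
  length (columns q s) + β (length (columns q s)) ∎
  where open ≤-Reasoning

rows-columns-weight : ∀ k t q s → let m = length (rows k t); n = length (columns q s) in
  weight m n (labelling (rows k t) (columns q s)) ≤ ⌈ m /3⌉ * (n + β n)
rows-columns-weight k t q s = begin
  weight _ _ (labelling (rows k t) (columns q s))
    ≡⟨ weight-labelling (rows k t) (columns q s) ⟩
  blockWeight (concat (rowBlocks k t)) (columns q s)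
    ≡⟨ sum-map-concat (λ r → rowWeight r (columns q s)) (rowBlocks k t) ⟩
  sum (map (λ B → blockWeight B (columns q s)) (rowBlocks k t))
    ≤⟨ sum-map-≤ (All.map (λ {B} → blockWeight-columns-≤ q s {B}) (rowBlocks-bounded k t)) ⟩
  length (rowBlocks k t) * (n + β n)
    ≡⟨ cong (_* (n + β n)) (⌈rows/3⌉ k t) ⟨
  ⌈ length (rows k t) /3⌉ * (n + β n) ∎
  where
  open ≤-Reasoning
  n : ℕ
  n = length (columns q s)

γr2≤-rows-columns : ∀ {m n} .{{_ : NonZero m}} .{{_ : NonZero n}} k t q s →
  m ≡ length (rows k t) → n ≡ length (columns q s) → γr2≤ m n (⌈ m /3⌉ * (n + β n))
γr2≤-rows-columns k t q s refl refl =
  labelling (rows k t) (columns q s) , rows-columns-is2RDF k t q s , rows-columns-weight k t q s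

corollary2 : (m n : ℕ) → (hm : 3 ≤ m) → (hn : 6 ≤ n) →
    γr2≤ m n {{nz (s≤s z≤n) hm}} {{nz (s≤s z≤n) hn}} (⌈ m /3⌉ * (n + β n))
corollary2 m n hm hn with m≥d⇒m≡[1+k]*d+r 3 hm | m≥d⇒m≡[1+k]*d+r 6 hn
... | k , t , m≡[1+k]*3+t | q , s , n≡[1+q]*6+s =
  γr2≤-rows-columns {{nz (s≤s z≤n) hm}} {{nz (s≤s z≤n) hn}} k t q s
    (trans m≡[1+k]*3+t (sym (length-rows k t)))
    (trans n≡[1+q]*6+s (sym (length-columns q s)))
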